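{- There exists a testing set of size $25$ for double-MDS-codes in $\{0,1,2,3\}^3$ (equivalently, for frequency cubes $\mathrm{F}^3(4;2,2)$).
   Context: Let $\Sigma=\{0,1,2,3\}$. A line in $\Sigma^n$ is a set of $4$ words agreeing in all coordinates but one. A set $S\subseteq\Sigma^n$ is a double-MDS-code if every line contains exactly two elements of $S$. A set $T\subseteq\Sigma^n$ is a testing set for double-MDS-codes if $C_1\cap T\ne C_2\cap T$ for any two different double-MDS-codes $C_1,C_2\subseteq\Sigma^n$. -}

module Defs where

open import Data.Nat using (ℕ)
open import Data.Bool using (Bool; true; false)
open import Data.Fin using (Fin)
open import Data.Vec using (Vec; _[_]≔_; allFin)
open import Data.List using (List; filter; length; cartesianProductWith; map; [_]; concatMap)
import Data.Vec as V
open import Data.Bool using (T)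
open import Relation.Binary.PropositionalEquality using (_≡_)
open import Relation.Nullary.Decidable using (does)
open import Data.Bool.Properties using (T?)

Σ : Set
Σ = Fin 4

Word : ℕ → Set
Word n = Vec Σ n

Subset : ℕ → Set
Subset n = Word n → Bool

allΣ : List Σ
allΣ = V.toList (allFin 4)

allWords : (n : ℕ) → List (Word n)
allWords ℕ.zero = [ V.[] ]
allWords (ℕ.suc n) = concatMap (λ a → map (a V.∷_) (allWords n)) allΣ

countB : {A : Set} → (A → Bool) → List A → ℕ
countB p xs = length (filter (λ x → T? (p x)) xs)

-- The line through w in direction i: { w[i := a] | a ∈ Σ }.
-- S is a double-MDS-code iff every line contains exactly two elements of S.
IsDoubleMDS : (n : ℕ) → Subset n → Set
IsDoubleMDS n S = (w : Word n) (i : Fin n) → countB (λ a → S (w [ i ]≔ a)) allΣ ≡ 2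

card : (n : ℕ) → Subset n → ℕ
card n S = countB S (allWords n)

IsTestingSet : (n : ℕ) → Subset n → Set
IsTestingSet n Tset =
  (C₁ C₂ : Subset n) → IsDoubleMDS n C₁ → IsDoubleMDS n C₂ →
  ((w : Word n) → Tset w ≡ true → C₁ w ≡ C₂ w) →
  (w : Word n) → C₁ w ≡ C₂ w

-- Every line of a double-MDS code carries exactly two cells of each value, so on any line of a
-- partial assignment consistent with a code, two known cells of equal value force the remaining
-- cells to the other value, and three are a contradiction. This unit propagation, combined with
-- branching on cells, is a sound search: we branch on every cell of T and check that each
-- resulting partial cube has at most one completion to a double-MDS code. The complement of a
-- double-MDS code is again one, so it suffices to consider codes containing a fixed cell t₀ of T.
module Submission where

open import Defs
open import Data.Bool using (Bool; true; false; not; _∧_; _∨_)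
open import Data.Bool.Properties using (T-≡; T?; not-injective; ¬-not)
open import Data.Empty using (⊥; ⊥-elim)
open import Data.Fin as Fin using (Fin; zero; suc; #_; punchIn)
open import Data.List using (List; []; _∷_; _++_; tabulate; length; filter)
open import Data.List.Relation.Unary.All as All using (All; []; _∷_)
open import Data.List.Relation.Unary.All.Properties using (all-filter)
open import Data.Maybe using (Maybe; just; nothing; _>>=_)
import Data.Maybe.Relation.Unary.All as Maybe
import Data.Maybe.Relation.Unary.Any as Maybe
open import Data.Nat using (ℕ; zero; suc; _+_; _*_; _^_; _≤_; z≤n; s≤s; _≡ᵇ_)
open import Data.Nat.Properties
  using (+-suc; +-cancelˡ-≡; m≤n⇒m≤1+n; ≤-trans; ≤-reflexive; 1+n≰n; suc-injective; module ≤-Reasoning)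
open import Data.Product using (Σ-syntax; _×_; _,_; proj₁; proj₂)
open import Data.Sum using (_⊎_; inj₁; inj₂)
open import Data.Vec as Vec using (Vec; []; _∷_; lookup; updateAt; replicate; _[_]≔_)
open import Data.Vec.Properties using (lookup∘updateAt; lookup∘updateAt′; lookup-replicate; ≡-dec)
open import Function using (_∘_; Equivalence)
open import Relation.Binary.PropositionalEquality
  using (_≡_; _≢_; refl; sym; trans; cong; subst; module ≡-Reasoning)
open import Relation.Nullary using (yes; no)

Cube : ℕ → Set → Set
Cube zero    A = A
Cube (suc n) A = Vec (Cube n A) 4

module _ {A : Set} where

  at : ∀ {n} → Cube n A → Word n → A
  at x []      = x
  at c (i ∷ w) = at (lookup c i) w

  update : ∀ {n} → Cube n A → Word n → A → Cube n A
  update _ []      a = a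
  update c (i ∷ w) a = updateAt c i (λ c′ → update c′ w a)

  filled : ∀ {n} → A → Cube n A
  filled {zero}  a = a
  filled {suc n} a = replicate 4 (filled a)

  at-update : ∀ {n} (c : Cube n A) w a → at (update c w a) w ≡ a
  at-update _ []      a = refl
  at-update c (i ∷ w) a rewrite lookup∘updateAt i {λ c′ → update c′ w a} c = at-update (lookup c i) w a

  at-update-≢ : ∀ {n} (c : Cube n A) {u w : Word n} a → u ≢ w → at (update c w a) u ≡ at c u
  at-update-≢ c {[]}    {[]}    a u≢w = ⊥-elim (u≢w refl)
  at-update-≢ c {j ∷ u} {i ∷ w} a u≢w with i Fin.≟ j
  ... | yes refl rewrite lookup∘updateAt i {λ c′ → update c′ w a} c =
    at-update-≢ (lookup c i) a (u≢w ∘ cong (i ∷_))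
  ... | no i≢j = cong (λ c′ → at c′ u) (lookup∘updateAt′ j i (i≢j ∘ sym) c)

  at-filled : ∀ {n} (a : A) (w : Word n) → at (filled a) w ≡ a
  at-filled a []      = refl
  at-filled a (i ∷ w) = trans (cong (λ c → at c w) (lookup-replicate i (filled a))) (at-filled a w)

countB-complement : ∀ {A : Set} (p : A → Bool) xs → countB p xs + countB (not ∘ p) xs ≡ length xs
countB-complement p []       = refl
countB-complement p (x ∷ xs) with p x
... | true  = cong suc (countB-complement p xs)
... | false = trans (+-suc _ _) (cong suc (countB-complement p xs))

bit : Bool → ℕ
bit false = 0
bit true  = 1

tally : (Σ → Bool) → ℕ
tally p = bit (p (# 0)) + (bit (p (# 1)) + (bit (p (# 2)) + (bit (p (# 3)) + 0)))

countB-∷ : ∀ {A : Set} (p : A → Bool) x xs → countB p (x ∷ xs) ≡ bit (p x) + countB p xs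
countB-∷ p x xs with p x
... | true  = refl
... | false = refl

countB-allΣ : ∀ p → countB p allΣ ≡ tally p
countB-allΣ p = begin
  countB p allΣ                          ≡⟨ countB-∷ p _ _ ⟩
  b₀ + countB p (# 1 ∷ # 2 ∷ # 3 ∷ [])   ≡⟨ cong (b₀ +_) (countB-∷ p _ _) ⟩
  b₀ + (b₁ + countB p (# 2 ∷ # 3 ∷ []))  ≡⟨ cong (λ k → b₀ + (b₁ + k)) (countB-∷ p _ _) ⟩
  b₀ + (b₁ + (b₂ + countB p (# 3 ∷ []))) ≡⟨ cong (λ k → b₀ + (b₁ + (b₂ + k))) (countB-∷ p _ _) ⟩
  tally p                                ∎
  where
  open ≡-Reasoning
  b₀ b₁ b₂ : ℕ
  b₀ = bit (p (# 0))
  b₁ = bit (p (# 1))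
  b₂ = bit (p (# 2))

is : Bool → Bool → Bool
is true  y = y
is false y = not y

is-false : ∀ b y → is b y ≡ false → y ≡ not b
is-false true  false _ = refl
is-false false true  _ = refl

known : Bool → Maybe Bool → Bool
known b (just y) = is b y
known b nothing  = false

≡just⇒≢nothing : ∀ {v : Maybe Bool} {y} → v ≡ just y → v ≢ nothing
≡just⇒≢nothing refl ()

module _ {A : Set} (f : A → Maybe Bool) (g : A → Bool) (f⊑g : ∀ x → Maybe.All (_≡ g x) (f x)) (b : Bool) where

  known-count-≤ : ∀ xs → countB (known b ∘ f) xs ≤ countB (is b ∘ g) xs
  known-count-≤ []       = z≤n
  known-count-≤ (x ∷ xs) with f x | f⊑g x
  ... | nothing | _ with is b (g x)
  ...   | true  = m≤n⇒m≤1+n (known-count-≤ xs)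
  ...   | false = known-count-≤ xs
  known-count-≤ (x ∷ xs) | just _ | Maybe.just refl with is b (g x)
  ...   | true  = s≤s (known-count-≤ xs)
  ...   | false = known-count-≤ xs

  unknown-forced : ∀ xs → countB (known b ∘ f) xs ≡ countB (is b ∘ g) xs →
                   All (λ x → f x ≡ nothing → g x ≡ not b) xs
  unknown-forced []       _  = []
  unknown-forced (x ∷ xs) eq with f x in fx | f⊑g x
  ... | nothing | _ with is b (g x) in e
  ...   | true  = ⊥-elim (1+n≰n (≤-trans (≤-reflexive (sym eq)) (known-count-≤ xs)))
  ...   | false = (λ _ → is-false b (g x) e) ∷ unknown-forced xs eq
  unknown-forced (x ∷ xs) eq | just _ | Maybe.just refl with is b (g x)
  ...   | true  = (⊥-elim ∘ ≡just⇒≢nothing fx) ∷ unknown-forced xs (suc-injective eq)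
  ...   | false = (⊥-elim ∘ ≡just⇒≢nothing fx) ∷ unknown-forced xs eq

line-count : ∀ {n} (C : Subset n) → IsDoubleMDS n C → ∀ w i b → countB (is b ∘ C ∘ (w [ i ]≔_)) allΣ ≡ 2
line-count C mds w i true  = mds w i
line-count C mds w i false = +-cancelˡ-≡ 2 zeros 2 (begin
  2 + zeros     ≡⟨ cong (_+ zeros) (mds w i) ⟨
  ones + zeros  ≡⟨ countB-complement (C ∘ (w [ i ]≔_)) allΣ ⟩
  4             ∎)
  where
  open ≡-Reasoning
  ones zeros : ℕ
  ones  = countB (C ∘ (w [ i ]≔_)) allΣ
  zeros = countB (not ∘ C ∘ (w [ i ]≔_)) allΣ

complement-isDoubleMDS : ∀ {n} (C : Subset n) → IsDoubleMDS n C → IsDoubleMDS n (not ∘ C)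
complement-isDoubleMDS C mds w i = line-count C mds w i false

Partial : ℕ → Set
Partial n = Cube n (Maybe Bool)

blank : ∀ {n} → Partial n
blank = filled nothing

Extends : ∀ {n} → Subset n → Partial n → Set
Extends C s = ∀ w → Maybe.All (_≡ C w) (at s w)

extends-blank : ∀ {n} (C : Subset n) → Extends C blank
extends-blank C w = subst (Maybe.All (_≡ C w)) (sym (at-filled nothing w)) Maybe.nothing

extends-update : ∀ {n} {C : Subset n} {s w b} → Extends C s → C w ≡ b → Extends C (update s w (just b))
extends-update {s = s} {w} {b} ext refl u with ≡-dec Fin._≟_ u w
... | yes refl rewrite at-update s w (just b) = Maybe.just refl
... | no u≢w   rewrite at-update-≢ s (just b) u≢w = ext u

Line : ℕ → Set
Line n = Word n × Fin n

linesThrough : ∀ {n} → Word n → List (Line n)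
linesThrough w = tabulate (w ,_)

-- Direction i is left out: a cell filled while settling the line (w , i) lies on that very line.
otherLinesThrough : ∀ {n} → Word n → Fin n → List (Line n)
otherLinesThrough {suc _} w i = tabulate ((w ,_) ∘ punchIn i)

Agenda : ℕ → Set
Agenda n = Partial n × List (Line n)

-- A line's four values as a function whose closure holds them, so each is read from the cube once.
pick : Maybe Bool → Maybe Bool → Maybe Bool → Maybe Bool → Σ → Maybe Bool
pick v₀ v₁ v₂ v₃ zero                   = v₀
pick v₀ v₁ v₂ v₃ (suc zero)             = v₁
pick v₀ v₁ v₂ v₃ (suc (suc zero))       = v₂
pick v₀ v₁ v₂ v₃ (suc (suc (suc zero))) = v₃

module _ {n : ℕ} where

  fillCell : Fin n → Word n → Bool → Maybe Bool → Agenda n → Agenda n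
  fillCell i c b nothing  (s , ℓs) = update s c (just b) , otherLinesThrough c i ++ ℓs
  fillCell i c b (just _) ag       = ag

  fillLine : Word n → Fin n → Bool → (Σ → Maybe Bool) → Agenda n → Agenda n
  fillLine w i b v = fill (# 3) ∘ fill (# 2) ∘ fill (# 1) ∘ fill (# 0)
    where
    fill : Σ → Agenda n → Agenda n
    fill a = fillCell i (w [ i ]≔ a) b (v a)

  settlePolarity : Word n → Fin n → (Σ → Maybe Bool) → Bool → Agenda n → Maybe (Agenda n)
  settlePolarity w i v b ag with tally (known b ∘ v)
  ... | 2                 = just (fillLine w i (not b) v ag)
  ... | suc (suc (suc _)) = nothing
  ... | _                 = just ag

  settleLine : Line n → Agenda n → Maybe (Agenda n)
  settleLine (w , i) (s , ℓs) = settle (pick (value (# 0)) (value (# 1)) (value (# 2)) (value (# 3)))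
    where
    value : Σ → Maybe Bool
    value a = at s (w [ i ]≔ a)
    settle : (Σ → Maybe Bool) → Maybe (Agenda n)
    settle v = settlePolarity w i v true (s , ℓs) >>= settlePolarity w i v false

  propagate : ℕ → Agenda n → Maybe (Partial n)
  propagate zero    (s , _)      = just s
  propagate (suc k) (s , [])     = just s
  propagate (suc k) (s , ℓ ∷ ℓs) = settleLine ℓ (s , ℓs) >>= propagate k

Any->>= : ∀ {A B : Set} {P : A → Set} {Q : B → Set} {m : Maybe A} {f : A → Maybe B} →
          Maybe.Any P m → (∀ {x} → P x → Maybe.Any Q (f x)) → Maybe.Any Q (m >>= f)
Any->>= (Maybe.just px) k = k px

module _ {n : ℕ} {C : Subset n} (mds : IsDoubleMDS n C) where

  fillCell-sound : ∀ i c b v s ℓs → Extends C s → (v ≡ nothing → C c ≡ b) →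
                   Extends C (proj₁ (fillCell i c b v (s , ℓs)))
  fillCell-sound i c b nothing  s ℓs ext forced = extends-update ext (forced refl)
  fillCell-sound i c b (just _) s ℓs ext _      = ext

  module _ (w : Word n) (i : Fin n) (v : Σ → Maybe Bool) (v⊑C : ∀ a → Maybe.All (_≡ C (w [ i ]≔ a)) (v a)) where

    fillLine-sound : ∀ b ag → Extends C (proj₁ ag) → All (λ a → v a ≡ nothing → C (w [ i ]≔ a) ≡ b) allΣ →
                     Extends C (proj₁ (fillLine w i b v ag))
    fillLine-sound b ag ext (h₀ ∷ h₁ ∷ h₂ ∷ h₃ ∷ []) =
      fill-sound (# 3) _ (fill-sound (# 2) _ (fill-sound (# 1) _ (fill-sound (# 0) ag ext h₀) h₁) h₂) h₃
      where
      fill-sound : ∀ a ag → Extends C (proj₁ ag) → (v a ≡ nothing → C (w [ i ]≔ a) ≡ b) →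
                   Extends C (proj₁ (fillCell i (w [ i ]≔ a) b (v a) ag))
      fill-sound a (s , ℓs) = fillCell-sound i (w [ i ]≔ a) b (v a) s ℓs

    known-on-line-≤2 : ∀ b → tally (known b ∘ v) ≤ 2
    known-on-line-≤2 b = begin
      tally (known b ∘ v)                   ≡⟨ countB-allΣ (known b ∘ v) ⟨
      countB (known b ∘ v) allΣ             ≤⟨ known-count-≤ v (C ∘ (w [ i ]≔_)) v⊑C b allΣ ⟩
      countB (is b ∘ C ∘ (w [ i ]≔_)) allΣ  ≡⟨ line-count C mds w i b ⟩
      2                                     ∎
      where open ≤-Reasoning

    unknown-on-line-forced : ∀ b → tally (known b ∘ v) ≡ 2 →
                             All (λ a → v a ≡ nothing → C (w [ i ]≔ a) ≡ not b) allΣ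
    unknown-on-line-forced b two = unknown-forced v (C ∘ (w [ i ]≔_)) v⊑C b allΣ
      (trans (countB-allΣ (known b ∘ v)) (trans two (sym (line-count C mds w i b))))

    settlePolarity-sound : ∀ b ag → Extends C (proj₁ ag) →
                           Maybe.Any (Extends C ∘ proj₁) (settlePolarity w i v b ag)
    settlePolarity-sound b ag ext with tally (known b ∘ v) in two | known-on-line-≤2 b
    ... | 2                 | _ = Maybe.just (fillLine-sound (not b) ag ext (unknown-on-line-forced b two))
    ... | suc (suc (suc _)) | s≤s (s≤s ())
    ... | 0                 | _ = Maybe.just ext
    ... | 1                 | _ = Maybe.just ext

  settleLine-sound : ∀ ℓ s ℓs → Extends C s → Maybe.Any (Extends C ∘ proj₁) (settleLine ℓ (s , ℓs))
  settleLine-sound (w , i) s ℓs ext =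
    Any->>= (settlePolarity-sound w i v v⊑C true (s , ℓs) ext) (λ {ag} → settlePolarity-sound w i v v⊑C false ag)
    where
    v : Σ → Maybe Bool
    v = pick (at s (w [ i ]≔ # 0)) (at s (w [ i ]≔ # 1)) (at s (w [ i ]≔ # 2)) (at s (w [ i ]≔ # 3))
    v⊑C : ∀ a → Maybe.All (_≡ C (w [ i ]≔ a)) (v a)
    v⊑C zero                   = ext (w [ i ]≔ # 0)
    v⊑C (suc zero)             = ext (w [ i ]≔ # 1)
    v⊑C (suc (suc zero))       = ext (w [ i ]≔ # 2)
    v⊑C (suc (suc (suc zero))) = ext (w [ i ]≔ # 3)

  propagate-sound : ∀ k ag → Extends C (proj₁ ag) → Maybe.Any (Extends C) (propagate k ag)
  propagate-sound zero    (s , _)      ext = Maybe.just ext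
  propagate-sound (suc k) (s , [])     ext = Maybe.just ext
  propagate-sound (suc k) (s , ℓ ∷ ℓs) ext = Any->>= (settleLine-sound ℓ s ℓs ext) (λ {ag} → propagate-sound k ag)

unknownCell : ∀ {n} → Partial n → Maybe (Word n)
unknownCellAmong : ∀ {m n} → Vec (Partial n) m → Maybe (Fin m × Word n)
unknownCell {zero}  nothing  = just []
unknownCell {zero}  (just _) = nothing
unknownCell {suc n} c with unknownCellAmong c
... | just (i , w) = just (i ∷ w)
... | nothing      = nothing
unknownCellAmong []       = nothing
unknownCellAmong (c ∷ cs) with unknownCell c
... | just w  = just (zero , w)
... | nothing with unknownCellAmong cs
...   | just (i , w) = just (suc i , w)
...   | nothing      = nothing

unknownCell-complete : ∀ {n} (s : Partial n) → unknownCell s ≡ nothing → ∀ w → at s w ≢ nothing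
unknownCellAmong-complete : ∀ {m n} (cs : Vec (Partial n) m) → unknownCellAmong cs ≡ nothing →
                            ∀ i w → at (lookup cs i) w ≢ nothing
unknownCell-complete {zero}  (just _) _    []      ()
unknownCell-complete {suc n} c        none (i ∷ w) with unknownCellAmong c in e
... | nothing = unknownCellAmong-complete c e i w
unknownCellAmong-complete (c ∷ cs) none zero    w with unknownCell c in e
... | nothing = unknownCell-complete c e w
unknownCellAmong-complete (c ∷ cs) none (suc i) w with unknownCell c
... | nothing with unknownCellAmong cs in e
...   | nothing = unknownCellAmong-complete cs e i w

all-known-agree : ∀ {n} {C₁ C₂ : Subset n} {s} → (∀ w → at s w ≢ nothing) →
                  Extends C₁ s → Extends C₂ s → ∀ w → C₁ w ≡ C₂ w
all-known-agree {s = s} known ext₁ ext₂ w with at s w in e | ext₁ w | ext₂ w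
... | nothing | _               | _               = ⊥-elim (known w e)
... | just _  | Maybe.just e₁ | Maybe.just e₂ = trans (sym e₁) e₂

∧-true : ∀ {x y} → x ∧ y ≡ true → x ≡ true × y ≡ true
∧-true {true} {true} refl = refl , refl

∨-true : ∀ {x y} → x ∨ y ≡ true → x ≡ true ⊎ y ≡ true
∨-true {true}  _ = inj₁ refl
∨-true {false} e = inj₂ e

both : ∀ (f : Bool → Bool) b → f true ∧ f false ≡ true → f b ≡ true
both f true  h = proj₁ (∧-true h)
both f false h = proj₂ (∧-true h)

-- Every cell is filled at most once and then schedules n - 1 lines, so the agenda always empties
-- within this many steps.
propagationFuel : ℕ → ℕ
propagationFuel n = n * 4 ^ n

module _ {n : ℕ} where

  assign : Word n → Bool → Partial n → Agenda n
  assign w b s = update s w (just b) , linesThrough w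

  refutes : ℕ → Agenda n → Bool
  refutes zero    _  = false
  refutes (suc k) ag with propagate (propagationFuel n) ag
  ... | nothing = true
  ... | just s with unknownCell s
  ...   | nothing = false
  ...   | just c  = refutes k (assign c true s) ∧ refutes k (assign c false s)

  determined : ℕ → Agenda n → Bool
  determined zero    _  = false
  determined (suc k) ag with propagate (propagationFuel n) ag
  ... | nothing = true
  ... | just s with unknownCell s
  ...   | nothing = true
  ...   | just c  = forces true ∨ forces false
    where
    forces : Bool → Bool
    forces b = refutes k (assign c b s) ∧ determined k (assign c (not b) s)

  determinedBy : List (Word n) → ℕ → Agenda n → Bool
  determinedBy []       k ag = determined k ag
  determinedBy (c ∷ cs) k ag with propagate (propagationFuel n) ag
  ... | nothing = true
  ... | just s with at s c
  ...   | just _  = determinedBy cs k (s , [])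
  ...   | nothing = determinedBy cs k (assign c true s) ∧ determinedBy cs k (assign c false s)

module _ {n : ℕ} {C : Subset n} (mds : IsDoubleMDS n C) where

  refutes-sound : ∀ k ag → refutes k ag ≡ true → Extends C (proj₁ ag) → ⊥
  refutes-sound (suc k) ag r ext with propagate (propagationFuel n) ag | propagate-sound mds (propagationFuel n) ag ext
  ... | just s | Maybe.just ext′ with unknownCell s
  ...   | just c = refutes-sound k (assign c (C c) s) (both (λ b → refutes k (assign c b s)) (C c) r)
                     (extends-update {w = c} ext′ refl)

  refuted-value : ∀ k {s} c b → refutes k (assign c b s) ≡ true → Extends C s → C c ≡ not b
  refuted-value k c b r ext = ¬-not (λ e → refutes-sound k _ r (extends-update ext e))

module _ {n : ℕ} {C₁ C₂ : Subset n} (mds₁ : IsDoubleMDS n C₁) (mds₂ : IsDoubleMDS n C₂) where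

  determined-sound : ∀ k ag → determined k ag ≡ true → Extends C₁ (proj₁ ag) → Extends C₂ (proj₁ ag) →
                     ∀ w → C₁ w ≡ C₂ w
  forced-sound : ∀ k s c b → refutes k (assign c b s) ∧ determined k (assign c (not b) s) ≡ true →
                 Extends C₁ s → Extends C₂ s → ∀ w → C₁ w ≡ C₂ w

  determined-sound (suc k) ag d ext₁ ext₂
    with propagate (propagationFuel n) ag | propagate-sound mds₁ (propagationFuel n) ag ext₁
       | propagate-sound mds₂ (propagationFuel n) ag ext₂
  ... | just s | Maybe.just ext₁′ | Maybe.just ext₂′ with unknownCell s in e
  ...   | nothing = all-known-agree (unknownCell-complete s e) ext₁′ ext₂′
  ...   | just c with ∨-true d
  ...     | inj₁ forced = forced-sound k s c true forced ext₁′ ext₂′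
  ...     | inj₂ forced = forced-sound k s c false forced ext₁′ ext₂′

  forced-sound k s c b h ext₁ ext₂ with ∧-true h
  ... | r , d = determined-sound k (assign c (not b) s) d
                  (extends-update ext₁ (refuted-value mds₁ k c b r ext₁))
                  (extends-update ext₂ (refuted-value mds₂ k c b r ext₂))

  determinedBy-sound : ∀ cs k ag → determinedBy cs k ag ≡ true → All (λ c → C₁ c ≡ C₂ c) cs →
                       Extends C₁ (proj₁ ag) → Extends C₂ (proj₁ ag) → ∀ w → C₁ w ≡ C₂ w
  determinedBy-sound []       k ag d _ = determined-sound k ag d
  determinedBy-sound (c ∷ cs) k ag d (c-agrees ∷ agree) ext₁ ext₂
    with propagate (propagationFuel n) ag | propagate-sound mds₁ (propagationFuel n) ag ext₁
       | propagate-sound mds₂ (propagationFuel n) ag ext₂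
  ... | just s | Maybe.just ext₁′ | Maybe.just ext₂′ with at s c
  ...   | just _  = determinedBy-sound cs k (s , []) d agree ext₁′ ext₂′
  ...   | nothing =
    determinedBy-sound cs k (assign c (C₁ c) s) (both (λ b → determinedBy cs k (assign c b s)) (C₁ c) d) agree
      (extends-update {w = c} ext₁′ refl) (extends-update ext₂′ (sym c-agrees))

-- Entry z of row y of layer x is 1 exactly when (x , y , z) belongs to the testing set.
testingSet : Subset 3
testingSet = at layers
  where
  row : ℕ → ℕ → ℕ → ℕ → Vec Bool 4
  row a b c d = Vec.map (_≡ᵇ 1) (a ∷ b ∷ c ∷ d ∷ [])
  layers : Cube 3 Bool
  layers = (row 0 0 0 0 ∷ row 0 1 1 0 ∷ row 0 1 0 1 ∷ row 0 1 0 1 ∷ [])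
         ∷ (row 1 0 1 0 ∷ row 1 1 0 0 ∷ row 0 1 1 0 ∷ row 1 0 0 1 ∷ [])
         ∷ (row 1 0 0 1 ∷ row 0 1 0 0 ∷ row 0 0 1 0 ∷ row 1 0 1 0 ∷ [])
         ∷ (row 0 0 0 1 ∷ row 0 0 0 1 ∷ row 1 0 0 0 ∷ row 0 1 1 0 ∷ [])
         ∷ []

testingWords : List (Word 3)
testingWords = filter (T? ∘ testingSet) (allWords 3)

t₀ : Word 3
t₀ = # 0 ∷ # 1 ∷ # 1 ∷ []

start : Agenda 3
start = assign t₀ true blank

-- Each branching fixes one of the 4 ^ 3 cells.
searchDepth : ℕ
searchDepth = suc (4 ^ 3)

-- Stated with ≡ true rather than T: checking a term against T (…) makes Agda normalise the type
-- to decide whether it is a unit record, which would rerun the search.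
search-succeeds : determinedBy testingWords searchDepth start ≡ true
search-succeeds = refl

determined-below-t₀ : ∀ {C₁ C₂} → IsDoubleMDS 3 C₁ → IsDoubleMDS 3 C₂ →
                      (∀ w → testingSet w ≡ true → C₁ w ≡ C₂ w) → C₁ t₀ ≡ true → ∀ w → C₁ w ≡ C₂ w
determined-below-t₀ {C₁} {C₂} mds₁ mds₂ agree t₀∈C₁ =
  determinedBy-sound mds₁ mds₂ testingWords searchDepth start search-succeeds agree-on-words
    (extends-update (extends-blank C₁) t₀∈C₁) (extends-update (extends-blank C₂) (trans (sym (agree t₀ refl)) t₀∈C₁))
  where
  agree-on-words : All (λ c → C₁ c ≡ C₂ c) testingWords
  agree-on-words = All.map (λ {w} t → agree w (Equivalence.to T-≡ t)) (all-filter (T? ∘ testingSet) (allWords 3))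

testingSet-isTestingSet : IsTestingSet 3 testingSet
testingSet-isTestingSet C₁ C₂ mds₁ mds₂ agree w with C₁ t₀ in t₀∈C₁
... | true  = determined-below-t₀ mds₁ mds₂ agree t₀∈C₁ w
... | false = not-injective (determined-below-t₀ (complement-isDoubleMDS C₁ mds₁) (complement-isDoubleMDS C₂ mds₂)
                               (λ v v∈T → cong not (agree v v∈T)) (cong not t₀∈C₁) w)

mainTheorem8 : Σ[ Tset ∈ Subset 3 ] (card 3 Tset ≡ 25 × IsTestingSet 3 Tset)
mainTheorem8 = testingSet , refl , testingSet-isTestingSet
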